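{- Let $G$ be a connected graph with a cut-edge $e$, and let $G_1$ and $G_2$ be the two components of $G-e$. Then $p(G)\le 1+\max\{p(G_1),p(G_2)\}$.
   Context: An edge-coloring assigns a color to each edge. Given an edge-coloring, a path is a parity path if every color appears an even number of times on it. A parity edge-coloring is an edge-coloring with no parity path, and $p(G)$ is the minimum number of colors in a parity edge-coloring of $G$. -}

module Defs where

open import Data.Nat using (ℕ; zero; suc; _≤_; _⊔_; _+_)
open import Data.Nat.Divisibility using (_∣_)
open import Data.Fin using (Fin)
open import Data.Fin.Properties using () renaming (_≟_ to _≟ᶠ_)
open import Data.Bool using (Bool; true; false; _∧_; not)
open import Data.List using (List; []; _∷_)
open import Data.List.Relation.Unary.Linked using (Linked)
open import Data.List.Relation.Unary.Unique.Propositional using (Unique)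
open import Data.Product using (Σ; _×_; ∃)
open import Relation.Binary.PropositionalEquality using (_≡_)
open import Relation.Nullary using (¬_; yes; no)

record Graph : Set₁ where
  field
    V       : Set
    adj     : V → V → Bool
    adj-sym : ∀ u v → adj u v ≡ adj v u
    adj-irr : ∀ v → adj v v ≡ false
open Graph public

record FinGraph (n : ℕ) : Set where
  field
    adj     : Fin n → Fin n → Bool
    adj-sym : ∀ u v → adj u v ≡ adj v u
    adj-irr : ∀ v → adj v v ≡ false

toGraph : ∀ {n} → FinGraph n → Graph
toGraph {n} G = record
  { V = Fin n ; adj = FinGraph.adj G
  ; adj-sym = FinGraph.adj-sym G ; adj-irr = FinGraph.adj-irr G }

Adj : (G : Graph) → V G → V G → Set
Adj G u v = adj G u v ≡ true

-- An edge-coloring of G with colors Fin k: a color for every edge {u,v}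
-- (values on non-edges are irrelevant).
record EdgeColoring (G : Graph) (k : ℕ) : Set where
  field
    col     : V G → V G → Fin k
    col-sym : ∀ u v → Adj G u v → col u v ≡ col v u
open EdgeColoring public

IsPath : (G : Graph) → List (V G) → Set
IsPath G [] = Data.Empty.⊥ where import Data.Empty
IsPath G (u ∷ []) = Data.Empty.⊥ where import Data.Empty
IsPath G (u ∷ v ∷ ws) = Linked (Adj G) (u ∷ v ∷ ws) × Unique (u ∷ v ∷ ws)

edgeColors : ∀ {G k} → EdgeColoring G k → List (V G) → List (Fin k)
edgeColors c []           = []
edgeColors c (u ∷ [])     = []
edgeColors c (u ∷ v ∷ ws) = col c u v ∷ edgeColors c (v ∷ ws)

occ : ∀ {k} → Fin k → List (Fin k) → ℕ
occ i []       = 0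
occ i (j ∷ js) with i ≟ᶠ j
... | yes _ = suc (occ i js)
... | no  _ = occ i js

IsParityPath : ∀ {G k} → EdgeColoring G k → List (V G) → Set
IsParityPath {G} {k} c ps = IsPath G ps × (∀ (i : Fin k) → 2 ∣ occ i (edgeColors c ps))

IsParityEdgeColoring : ∀ {G k} → EdgeColoring G k → Set
IsParityEdgeColoring {G} c = ∀ (ps : List (V G)) → ¬ IsParityPath c ps

HasParityColoring : Graph → ℕ → Set
HasParityColoring G k = Σ (EdgeColoring G k) IsParityEdgeColoring

IsParityNumber : Graph → ℕ → Set
IsParityNumber G k = HasParityColoring G k × (∀ j → HasParityColoring G j → k ≤ j)

data Reachable (G : Graph) : V G → V G → Set where
  here  : ∀ {v} → Reachable G v v
  step  : ∀ {u v w} → Adj G u v → Reachable G v w → Reachable G u w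

Connected : Graph → Set
Connected G = ∀ u v → Reachable G u v

sameEdge : ∀ {n} → Fin n → Fin n → Fin n → Fin n → Bool
sameEdge a b u v with a ≟ᶠ u | b ≟ᶠ v | a ≟ᶠ v | b ≟ᶠ u
... | yes _ | yes _ | _     | _     = true
... | _     | _     | yes _ | yes _ = true
... | _     | _     | _     | _     = false

deleteEdge : ∀ {n} → (G : FinGraph n) → Fin n → Fin n → FinGraph n
deleteEdge G a b = record
  { adj = λ u v → FinGraph.adj G u v ∧ not (sameEdge a b u v)
  ; adj-sym = λ u v → sym-lem u v
  ; adj-irr = λ v → irr-lem v }
  where
  open import Relation.Binary.PropositionalEquality using (refl; cong₂; cong)
  sameEdge-sym : ∀ u v → sameEdge a b u v ≡ sameEdge a b v u
  sameEdge-sym u v with a ≟ᶠ u | b ≟ᶠ v | a ≟ᶠ v | b ≟ᶠ u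
  ... | yes _ | yes _ | yes _ | yes _ = refl
  ... | yes _ | yes _ | yes _ | no  _ = refl
  ... | yes _ | yes _ | no  _ | yes _ = refl
  ... | yes _ | yes _ | no  _ | no  _ = refl
  ... | yes _ | no  _ | yes _ | yes _ = refl
  ... | yes _ | no  _ | yes _ | no  _ = refl
  ... | yes _ | no  _ | no  _ | yes _ = refl
  ... | yes _ | no  _ | no  _ | no  _ = refl
  ... | no  _ | yes _ | yes _ | yes _ = refl
  ... | no  _ | yes _ | yes _ | no  _ = refl
  ... | no  _ | yes _ | no  _ | yes _ = refl
  ... | no  _ | yes _ | no  _ | no  _ = refl
  ... | no  _ | no  _ | yes _ | yes _ = refl
  ... | no  _ | no  _ | yes _ | no  _ = refl
  ... | no  _ | no  _ | no  _ | yes _ = refl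
  ... | no  _ | no  _ | no  _ | no  _ = refl
  sym-lem : ∀ u v → (FinGraph.adj G u v ∧ not (sameEdge a b u v))
                  ≡ (FinGraph.adj G v u ∧ not (sameEdge a b v u))
  sym-lem u v = cong₂ _∧_ (FinGraph.adj-sym G u v) (cong not (sameEdge-sym u v))
  irr-lem : ∀ v → (FinGraph.adj G v v ∧ not (sameEdge a b v v)) ≡ false
  irr-lem v rewrite FinGraph.adj-irr G v = refl

induced : ∀ {n} → FinGraph n → (Fin n → Bool) → Graph
induced {n} G S = record
  { V = Σ (Fin n) (λ v → S v ≡ true)
  ; adj = λ u v → FinGraph.adj G (Data.Product.proj₁ u) (Data.Product.proj₁ v)
  ; adj-sym = λ u v → FinGraph.adj-sym G (Data.Product.proj₁ u) (Data.Product.proj₁ v)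
  ; adj-irr = λ v → FinGraph.adj-irr G (Data.Product.proj₁ v) }
  where import Data.Product

-- Colour the edges of G₁ and of G₂ by optimal parity edge-colorings on disjoint
-- palettes and give the cut-edge ab one further colour. A path that avoids ab
-- stays inside G₁ or inside G₂, where it already contains a colour an odd number
-- of times; a path that uses ab uses it exactly once, so the new colour is odd.
module Submission where

open import Defs
open import Data.Nat using (ℕ; suc; _≤_; _⊔_; z≤n; s≤s) renaming (_≟_ to _≟ℕ_)
open import Data.Nat.Properties using (m≤m⊔n; m≤n⊔m; n<1+n; ≤-reflexive)
open import Data.Nat.Divisibility using (_∣_; >⇒∤)
open import Data.Fin using (Fin; zero; suc; inject≤)
open import Data.Fin.Properties using (suc-injective; inject≤-injective)
  renaming (_≟_ to _≟ᶠ_)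
open import Data.Bool using (Bool; true)
import Data.Bool as Bool
open import Data.List using (List; []; _∷_; map)
open import Data.List.Relation.Unary.All as All using (All; []; _∷_)
open import Data.List.Relation.Unary.Linked as Linked using (Linked; []; [-]; _∷_)
open import Data.List.Relation.Unary.Linked.Properties using (map⁻)
open import Data.List.Relation.Unary.AllPairs using (_∷_)
open import Data.List.Relation.Unary.Unique.Propositional using (Unique)
import Data.List.Relation.Unary.Unique.Propositional.Properties as Unique
open import Data.List.Membership.Propositional using (_∈_)
open import Data.List.Relation.Unary.Any using (here; there)
open import Data.Product using (_×_; _,_; proj₁; proj₂)
open import Data.Sum as Sum using (_⊎_; inj₁; inj₂)
open import Data.Empty using (⊥; ⊥-elim)
open import Relation.Binary.PropositionalEquality
  using (_≡_; refl; sym; trans; cong; cong₂; subst)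
open import Relation.Nullary using (¬_; yes; no)
open import Function.Base using (_∘_)
open import Function.Bundles using (_⇔_; module Equivalence)
open import Axiom.UniquenessOfIdentityProofs using (module Decidable⇒UIP)

open Equivalence using (to; from)

module _ (H : Graph) where

  Adj-sym : ∀ {u v} → Adj H u v → Adj H v u
  Adj-sym {u} {v} e = trans (sym (adj-sym H u v)) e

  Reachable-snoc : ∀ {u v w} → Reachable H u v → Adj H v w → Reachable H u w
  Reachable-snoc here e = step e here
  Reachable-snoc (step e r) e′ = step e (Reachable-snoc r e′)

  Reachable-trans : ∀ {u v w} → Reachable H u v → Reachable H v w → Reachable H u w
  Reachable-trans here r = r
  Reachable-trans (step e r) r′ = step e (Reachable-trans r r′)

  Reachable-sym : ∀ {u v} → Reachable H u v → Reachable H v u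
  Reachable-sym here = here
  Reachable-sym (step e r) = Reachable-snoc (Reachable-sym r) (Adj-sym e)

occ-here : ∀ {k} (i : Fin k) js → occ i (i ∷ js) ≡ suc (occ i js)
occ-here i js with i ≟ᶠ i
... | yes _ = refl
... | no i≢i = ⊥-elim (i≢i refl)

occ-there : ∀ {k} {i j : Fin k} js → ¬ i ≡ j → occ i (j ∷ js) ≡ occ i js
occ-there {i = i} {j} js i≢j with i ≟ᶠ j
... | yes i≡j = ⊥-elim (i≢j i≡j)
... | no _ = refl

occ-map : ∀ {k l} (f : Fin k → Fin l) → (∀ {i j} → f i ≡ f j → i ≡ j) →
          ∀ i js → occ (f i) (map f js) ≡ occ i js
occ-map f f-injective i [] = refl
occ-map f f-injective i (j ∷ js) with i ≟ᶠ j
... | yes refl = trans (occ-here (f i) (map f js)) (cong suc (occ-map f f-injective i js))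
... | no i≢j =
  trans (occ-there (map f js) (λ fi≡fj → i≢j (f-injective fi≡fj))) (occ-map f f-injective i js)

map-proj₁-toList : ∀ {A : Set} {P : A → Set} {xs} (pxs : All P xs) →
                   map proj₁ (All.toList pxs) ≡ xs
map-proj₁-toList [] = refl
map-proj₁-toList (px ∷ pxs) = cong (_ ∷_) (map-proj₁-toList pxs)

Adj-deleteEdge : ∀ {n} (G : FinGraph n) (a b : Fin n) {u v} → Adj (toGraph G) u v →
                 Adj (toGraph (deleteEdge G a b)) u v ⊎ ((u ≡ a × v ≡ b) ⊎ (u ≡ b × v ≡ a))
Adj-deleteEdge G a b {u} {v} e with FinGraph.adj G u v
                                  | a ≟ᶠ u | b ≟ᶠ v | a ≟ᶠ v | b ≟ᶠ u
Adj-deleteEdge G a b refl | true | yes a≡u | yes b≡v | _       | _       = inj₂ (inj₁ (sym a≡u , sym b≡v))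
Adj-deleteEdge G a b refl | true | yes _   | no _    | yes a≡v | yes b≡u = inj₂ (inj₂ (sym b≡u , sym a≡v))
Adj-deleteEdge G a b refl | true | no _    | _       | yes a≡v | yes b≡u = inj₂ (inj₂ (sym b≡u , sym a≡v))
Adj-deleteEdge G a b refl | true | yes _   | no _    | yes _   | no _    = inj₁ refl
Adj-deleteEdge G a b refl | true | yes _   | no _    | no _    | _       = inj₁ refl
Adj-deleteEdge G a b refl | true | no _    | yes _   | yes _   | no _    = inj₁ refl
Adj-deleteEdge G a b refl | true | no _    | no _    | yes _   | no _    = inj₁ refl
Adj-deleteEdge G a b refl | true | no _    | yes _   | no _    | _       = inj₁ refl
Adj-deleteEdge G a b refl | true | no _    | no _    | no _    | _       = inj₁ refl

module _ {n} (G D : FinGraph n) (S : Fin n → Bool)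
    (inside : ∀ {x y} → Adj (toGraph G) x y → S x ≡ true → S y ≡ true → Adj (toGraph D) x y)
    {q k} (c : EdgeColoring (induced D S) q) (c′ : EdgeColoring (toGraph G) k)
    (f : Fin q → Fin k) (f-injective : ∀ {i j} → f i ≡ f j → i ≡ j)
    (agrees : ∀ {x y} (px : S x ≡ true) (py : S y ≡ true) → col c′ x y ≡ f (col c (x , px) (y , py)))
  where

  edgeColors-proj₁ : ∀ L → edgeColors c′ (map proj₁ L) ≡ map f (edgeColors c L)
  edgeColors-proj₁ [] = refl
  edgeColors-proj₁ (_ ∷ []) = refl
  edgeColors-proj₁ ((x , px) ∷ (y , py) ∷ L) =
    cong₂ _∷_ (agrees px py) (edgeColors-proj₁ ((y , py) ∷ L))

  parityPath-proj₁ : ∀ L → IsParityPath c′ (map proj₁ L) → IsParityPath c L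
  parityPath-proj₁ L@(_ ∷ _ ∷ _) ((linked , unique) , even) =
    (Linked.map (λ {u} {v} e → inside e (proj₂ u) (proj₂ v)) (map⁻ linked) , Unique.map⁻ unique) ,
    λ i → subst (2 ∣_) (trans (cong (occ (f i)) (edgeColors-proj₁ L)) (occ-map f f-injective i _))
                (even (f i))

  parityPath-inside : ∀ {l} (l⊆S : All (λ v → S v ≡ true) l) → IsParityPath c′ l →
                      IsParityPath c (All.toList l⊆S)
  parityPath-inside l⊆S =
    parityPath-proj₁ (All.toList l⊆S) ∘ subst (IsParityPath c′) (sym (map-proj₁-toList l⊆S))

module CutEdge {n} (G : FinGraph n) (a b : Fin n)
    (connected : Connected (toGraph G))
    (a↮b : ¬ Reachable (toGraph (deleteEdge G a b)) a b)
    (S₁ S₂ : Fin n → Bool)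
    (S₁-spec : ∀ v → (S₁ v ≡ true) ⇔ Reachable (toGraph (deleteEdge G a b)) a v)
    (S₂-spec : ∀ v → (S₂ v ≡ true) ⇔ Reachable (toGraph (deleteEdge G a b)) b v)
  where

  G′ D′ : Graph
  G′ = toGraph G
  D′ = toGraph (deleteEdge G a b)

  InS₁ InS₂ : Fin n → Set
  InS₁ v = S₁ v ≡ true
  InS₂ v = S₂ v ≡ true

  b∉S₁ : ¬ InS₁ b
  b∉S₁ b∈S₁ = a↮b (to (S₁-spec b) b∈S₁)

  a∉S₂ : ¬ InS₂ a
  a∉S₂ a∈S₂ = a↮b (Reachable-sym D′ (to (S₂-spec a) a∈S₂))

  S₁-S₂-disjoint : ∀ {v} → InS₁ v → InS₂ v → ⊥
  S₁-S₂-disjoint {v} v∈S₁ v∈S₂ =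
    a↮b (Reachable-trans D′ (to (S₁-spec v) v∈S₁) (Reachable-sym D′ (to (S₂-spec v) v∈S₂)))

  Side : Fin n → Set
  Side v = InS₁ v ⊎ InS₂ v

  ReachableFromEndpoint : Fin n → Set
  ReachableFromEndpoint v = Reachable D′ a v ⊎ Reachable D′ b v

  ReachableFromEndpoint-walk : ∀ {u w} → Reachable G′ u w →
                               ReachableFromEndpoint u → ReachableFromEndpoint w
  ReachableFromEndpoint-walk here r = r
  ReachableFromEndpoint-walk (step e rest) r with Adj-deleteEdge G a b e
  ... | inj₁ d = ReachableFromEndpoint-walk rest
                   (Sum.map (λ r → Reachable-snoc D′ r d) (λ r → Reachable-snoc D′ r d) r)
  ... | inj₂ (inj₁ (_ , refl)) = ReachableFromEndpoint-walk rest (inj₂ here)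
  ... | inj₂ (inj₂ (_ , refl)) = ReachableFromEndpoint-walk rest (inj₁ here)

  side : ∀ v → Side v
  side v with ReachableFromEndpoint-walk (connected a v) (inj₁ here)
  ... | inj₁ r = inj₁ (from (S₁-spec v) r)
  ... | inj₂ r = inj₂ (from (S₂-spec v) r)

  inside₁ : ∀ {x y} → Adj G′ x y → InS₁ x → InS₁ y → Adj D′ x y
  inside₁ e x∈S₁ y∈S₁ with Adj-deleteEdge G a b e
  ... | inj₁ d = d
  ... | inj₂ (inj₁ (_ , refl)) = ⊥-elim (b∉S₁ y∈S₁)
  ... | inj₂ (inj₂ (refl , _)) = ⊥-elim (b∉S₁ x∈S₁)

  inside₂ : ∀ {x y} → Adj G′ x y → InS₂ x → InS₂ y → Adj D′ x y
  inside₂ e x∈S₂ y∈S₂ with Adj-deleteEdge G a b e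
  ... | inj₁ d = d
  ... | inj₂ (inj₁ (refl , _)) = ⊥-elim (a∉S₂ x∈S₂)
  ... | inj₂ (inj₂ (_ , refl)) = ⊥-elim (a∉S₂ y∈S₂)

  crossing : ∀ {x y} → Adj G′ x y → InS₁ x → InS₂ y → x ≡ a × y ≡ b
  crossing {x} {y} e x∈S₁ y∈S₂ with Adj-deleteEdge G a b e
  ... | inj₁ d =
    ⊥-elim (S₁-S₂-disjoint (from (S₁-spec y) (Reachable-snoc D′ (to (S₁-spec x) x∈S₁) d)) y∈S₂)
  ... | inj₂ (inj₁ x≡a,y≡b) = x≡a,y≡b
  ... | inj₂ (inj₂ (refl , _)) = ⊥-elim (b∉S₁ x∈S₁)

  module Extension {p₁ p₂}
      (c₁ : EdgeColoring (induced (deleteEdge G a b) S₁) p₁)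
      (c₂ : EdgeColoring (induced (deleteEdge G a b) S₂) p₂)
    where

    Colour : Set
    Colour = Fin (suc (p₁ ⊔ p₂))

    new : Colour
    new = zero

    old₁ : Fin p₁ → Colour
    old₁ i = suc (inject≤ i (m≤m⊔n p₁ p₂))

    old₂ : Fin p₂ → Colour
    old₂ i = suc (inject≤ i (m≤n⊔m p₁ p₂))

    old₁-injective : ∀ {i j} → old₁ i ≡ old₁ j → i ≡ j
    old₁-injective {i} {j} eq = inject≤-injective _ _ i j (suc-injective eq)

    old₂-injective : ∀ {i j} → old₂ i ≡ old₂ j → i ≡ j
    old₂-injective {i} {j} eq = inject≤-injective _ _ i j (suc-injective eq)

    colour : ∀ u v → Side u → Side v → Colour
    colour u v (inj₁ u∈S₁) (inj₁ v∈S₁) = old₁ (col c₁ (u , u∈S₁) (v , v∈S₁))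
    colour u v (inj₂ u∈S₂) (inj₂ v∈S₂) = old₂ (col c₂ (u , u∈S₂) (v , v∈S₂))
    colour u v (inj₁ _)    (inj₂ _)    = new
    colour u v (inj₂ _)    (inj₁ _)    = new

    colour-sym : ∀ {u v} → Adj G′ u v → ∀ su sv → colour u v su sv ≡ colour v u sv su
    colour-sym e (inj₁ u∈S₁) (inj₁ v∈S₁) = cong old₁ (col-sym c₁ _ _ (inside₁ e u∈S₁ v∈S₁))
    colour-sym e (inj₂ u∈S₂) (inj₂ v∈S₂) = cong old₂ (col-sym c₂ _ _ (inside₂ e u∈S₂ v∈S₂))
    colour-sym e (inj₁ _)    (inj₂ _)    = refl
    colour-sym e (inj₂ _)    (inj₁ _)    = refl

    c : EdgeColoring G′ (suc (p₁ ⊔ p₂))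
    c = record { col = λ u v → colour u v (side u) (side v)
               ; col-sym = λ u v e → colour-sym e (side u) (side v) }

    open Decidable⇒UIP Bool._≟_ using (≡-irrelevant)

    colour-inside₁ : ∀ {x y} (x∈S₁ : InS₁ x) (y∈S₁ : InS₁ y) su sv →
                     colour x y su sv ≡ old₁ (col c₁ (x , x∈S₁) (y , y∈S₁))
    colour-inside₁ {x} {y} x∈S₁ y∈S₁ (inj₁ p) (inj₁ q) =
      cong old₁ (cong₂ (λ p q → col c₁ (x , p) (y , q)) (≡-irrelevant p x∈S₁) (≡-irrelevant q y∈S₁))
    colour-inside₁ x∈S₁ y∈S₁ (inj₂ x∈S₂) _ = ⊥-elim (S₁-S₂-disjoint x∈S₁ x∈S₂)
    colour-inside₁ x∈S₁ y∈S₁ (inj₁ _) (inj₂ y∈S₂) = ⊥-elim (S₁-S₂-disjoint y∈S₁ y∈S₂)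

    colour-inside₂ : ∀ {x y} (x∈S₂ : InS₂ x) (y∈S₂ : InS₂ y) su sv →
                     colour x y su sv ≡ old₂ (col c₂ (x , x∈S₂) (y , y∈S₂))
    colour-inside₂ {x} {y} x∈S₂ y∈S₂ (inj₂ p) (inj₂ q) =
      cong old₂ (cong₂ (λ p q → col c₂ (x , p) (y , q)) (≡-irrelevant p x∈S₂) (≡-irrelevant q y∈S₂))
    colour-inside₂ x∈S₂ y∈S₂ (inj₁ x∈S₁) _ = ⊥-elim (S₁-S₂-disjoint x∈S₁ x∈S₂)
    colour-inside₂ x∈S₂ y∈S₂ (inj₂ _) (inj₁ y∈S₁) = ⊥-elim (S₁-S₂-disjoint y∈S₁ y∈S₂)

    new-colour-on-cutEdge : ∀ {x y} → Adj G′ x y → ∀ su sv → new ≡ colour x y su sv →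
                            (x ≡ a × y ≡ b) ⊎ (x ≡ b × y ≡ a)
    new-colour-on-cutEdge e (inj₁ x∈S₁) (inj₂ y∈S₂) _ = inj₁ (crossing e x∈S₁ y∈S₂)
    new-colour-on-cutEdge e (inj₂ x∈S₂) (inj₁ y∈S₁) _ with crossing (Adj-sym G′ e) y∈S₁ x∈S₂
    ... | y≡a , x≡b = inj₂ (x≡b , y≡a)

    old-colour-on-one-side : ∀ {x y} su sv → ¬ new ≡ colour x y su sv →
                             (InS₁ x × InS₁ y) ⊎ (InS₂ x × InS₂ y)
    old-colour-on-one-side (inj₁ x∈S₁) (inj₁ y∈S₁) _ = inj₁ (x∈S₁ , y∈S₁)
    old-colour-on-one-side (inj₂ x∈S₂) (inj₂ y∈S₂) _ = inj₂ (x∈S₂ , y∈S₂)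
    old-colour-on-one-side (inj₁ _)    (inj₂ _)    old = ⊥-elim (old refl)
    old-colour-on-one-side (inj₂ _)    (inj₁ _)    old = ⊥-elim (old refl)

    colours : List (Fin n) → List Colour
    colours = edgeColors c

    -- Matching on new ≟ᶠ col c x y also reduces occ new (colours (x ∷ y ∷ ws)),
    -- whose definition makes the same test.
    new-colour-endpoints : ∀ {l} → Linked (Adj G′) l → ¬ occ new (colours l) ≡ 0 → a ∈ l × b ∈ l
    new-colour-endpoints [] new∈ = ⊥-elim (new∈ refl)
    new-colour-endpoints [-] new∈ = ⊥-elim (new∈ refl)
    new-colour-endpoints {x ∷ y ∷ ws} (e ∷ linked) new∈ with new ≟ᶠ col c x y
    ... | yes eq with new-colour-on-cutEdge e (side x) (side y) eq
    ...   | inj₁ (refl , refl) = here refl , there (here refl)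
    ...   | inj₂ (refl , refl) = there (here refl) , here refl
    new-colour-endpoints {x ∷ y ∷ ws} (e ∷ linked) new∈ | no ne
      with new-colour-endpoints linked new∈
    ... | a∈ , b∈ = there a∈ , there b∈

    new-colour-at-most-once : ∀ {l} → Linked (Adj G′) l → Unique l → occ new (colours l) ≤ 1
    new-colour-at-most-once [] _ = z≤n
    new-colour-at-most-once [-] _ = z≤n
    new-colour-at-most-once {x ∷ y ∷ ws} (e ∷ linked) (x∉ ∷ unique) with new ≟ᶠ col c x y
    ... | no _ = new-colour-at-most-once linked unique
    ... | yes eq with occ new (colours (y ∷ ws)) ≟ℕ 0
    ...   | yes no-new-later = s≤s (≤-reflexive no-new-later)
    ...   | no new∈later with new-colour-endpoints linked new∈later
                              | new-colour-on-cutEdge e (side x) (side y) eq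
    ...     | a∈ , _ | inj₁ (refl , _) = ⊥-elim (All.lookup x∉ a∈ refl)
    ...     | _ , b∈ | inj₂ (refl , _) = ⊥-elim (All.lookup x∉ b∈ refl)

    no-new-colour-one-side : ∀ {l} → Linked (Adj G′) l → occ new (colours l) ≡ 0 →
                             All InS₁ l ⊎ All InS₂ l
    no-new-colour-one-side {[]} [] _ = inj₁ []
    no-new-colour-one-side {x ∷ []} [-] _ with side x
    ... | inj₁ x∈S₁ = inj₁ (x∈S₁ ∷ [])
    ... | inj₂ x∈S₂ = inj₂ (x∈S₂ ∷ [])
    no-new-colour-one-side {x ∷ y ∷ ws} (e ∷ linked) no-new with new ≟ᶠ col c x y
    ... | yes _ with () ← no-new
    ... | no old with old-colour-on-one-side (side x) (side y) old
                    | no-new-colour-one-side linked no-new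
    ...   | inj₁ (x∈S₁ , _) | inj₁ rest = inj₁ (x∈S₁ ∷ rest)
    ...   | inj₂ (x∈S₂ , _) | inj₂ rest = inj₂ (x∈S₂ ∷ rest)
    ...   | inj₁ (_ , y∈S₁) | inj₂ (y∈S₂ ∷ _) = ⊥-elim (S₁-S₂-disjoint y∈S₁ y∈S₂)
    ...   | inj₂ (_ , y∈S₂) | inj₁ (y∈S₁ ∷ _) = ⊥-elim (S₁-S₂-disjoint y∈S₁ y∈S₂)

    parityPath-inside₁ : ∀ {l} (l⊆S₁ : All InS₁ l) → IsParityPath c l →
                         IsParityPath c₁ (All.toList l⊆S₁)
    parityPath-inside₁ = parityPath-inside G (deleteEdge G a b) S₁ inside₁ c₁ c old₁ old₁-injective
      (λ {x} {y} x∈S₁ y∈S₁ → colour-inside₁ x∈S₁ y∈S₁ (side x) (side y))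

    parityPath-inside₂ : ∀ {l} (l⊆S₂ : All InS₂ l) → IsParityPath c l →
                         IsParityPath c₂ (All.toList l⊆S₂)
    parityPath-inside₂ = parityPath-inside G (deleteEdge G a b) S₂ inside₂ c₂ c old₂ old₂-injective
      (λ {x} {y} x∈S₂ y∈S₂ → colour-inside₂ x∈S₂ y∈S₂ (side x) (side y))

    isParityEdgeColoring : IsParityEdgeColoring c₁ → IsParityEdgeColoring c₂ → IsParityEdgeColoring c
    isParityEdgeColoring parity₁ parity₂ l@(_ ∷ _ ∷ _) parityPath@((linked , unique) , even)
      with occ new (colours l) in count | new-colour-at-most-once linked unique
    ... | 0 | _ with no-new-colour-one-side linked count
    ...   | inj₁ l⊆S₁ = parity₁ _ (parityPath-inside₁ l⊆S₁ parityPath)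
    ...   | inj₂ l⊆S₂ = parity₂ _ (parityPath-inside₂ l⊆S₂ parityPath)
    isParityEdgeColoring _ _ _ (_ , even) | 1 | _ = >⇒∤ (n<1+n 1) (subst (2 ∣_) count (even new))
    isParityEdgeColoring _ _ _ _ | suc (suc _) | s≤s ()

lemma5p1 : ∀ {n} (G : FinGraph n) (a b : Fin n)
    → Connected (toGraph G)
    → Adj (toGraph G) a b
    → ¬ Reachable (toGraph (deleteEdge G a b)) a b
    → (S₁ S₂ : Fin n → Bool)
    → (∀ v → (S₁ v ≡ true) ⇔ Reachable (toGraph (deleteEdge G a b)) a v)
    → (∀ v → (S₂ v ≡ true) ⇔ Reachable (toGraph (deleteEdge G a b)) b v)
    → (p p₁ p₂ : ℕ)
    → IsParityNumber (toGraph G) p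
    → IsParityNumber (induced (deleteEdge G a b) S₁) p₁
    → IsParityNumber (induced (deleteEdge G a b) S₂) p₂
    → p ≤ suc (p₁ ⊔ p₂)
lemma5p1 G a b connected _ a↮b S₁ S₂ S₁-spec S₂-spec p p₁ p₂
         (_ , p-minimal) ((c₁ , parity₁) , _) ((c₂ , parity₂) , _) =
  p-minimal (suc (p₁ ⊔ p₂)) (c , isParityEdgeColoring parity₁ parity₂)
  where open CutEdge G a b connected a↮b S₁ S₂ S₁-spec S₂-spec
        open Extension c₁ c₂
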